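{- Let \(G\) be a graph and \(v\) a vertex of degree \(2\) in \(G\). If \(\vec G\) is a complete-convex orientation of \(G\), then \(v\) is contained in a directed \(3\)-cycle in \(\vec G\).
   Context: Graphs are connected with at least two vertices and no parallel edges. A \(2\)-dipath \(u,v,w\) with centre \(v\): \(uv,vw\) arcs, \(u\ne v\ne w\). A vertex set \(S\) is convex if no vertex outside \(S\) is the centre of a \(2\)-dipath with both ends in \(S\); \(conv(S)\) is the smallest convex superset of \(S\). An oriented graph is complete convex if \(conv(\{u,v\})\) is the whole vertex set for every arc \(uv\). -}

module Defs where

open import Data.Nat using (ℕ; _≤_)
open import Data.Bool using (Bool; true; false)
open import Data.Fin using (Fin)
open import Data.Fin.Subset using (Subset; _∈_; _∉_; ⁅_⁆; _∪_; ∣_∣)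
open import Data.Vec using (tabulate)
open import Data.Product using (_×_; ∃₂)
open import Data.Sum using (_⊎_)
open import Relation.Binary.PropositionalEquality using (_≡_; _≢_)
open import Relation.Nullary using (¬_)

record Graph (n : ℕ) : Set where
  field
    adj       : Fin n → Fin n → Bool
    adj-sym   : ∀ u v → adj u v ≡ true → adj v u ≡ true
    adj-irrefl : ∀ v → adj v v ≡ false
open Graph public

data Reachable {n : ℕ} (G : Graph n) : Fin n → Fin n → Set where
  here : ∀ {u} → Reachable G u u
  step : ∀ {u v w} → adj G u v ≡ true → Reachable G v w → Reachable G u w

Connected : {n : ℕ} → Graph n → Set
Connected G = ∀ u v → Reachable G u v

nbhd : {n : ℕ} → Graph n → Fin n → Subset n
nbhd G v = tabulate (adj G v)

degree : {n : ℕ} → Graph n → Fin n → ℕ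
degree G v = ∣ nbhd G v ∣

record Orientation {n : ℕ} (G : Graph n) : Set where
  field
    arc        : Fin n → Fin n → Bool
    arc-edge   : ∀ u v → arc u v ≡ true → adj G u v ≡ true
    edge-arc   : ∀ u v → adj G u v ≡ true → arc u v ≡ true ⊎ arc v u ≡ true
    arc-asym   : ∀ u v → arc u v ≡ true → arc v u ≡ false
open Orientation public

TwoDipath : {n : ℕ} {G : Graph n} → Orientation G → Fin n → Fin n → Fin n → Set
TwoDipath D x c y = arc D x c ≡ true × arc D c y ≡ true × x ≢ c × c ≢ y

Convex : {n : ℕ} {G : Graph n} → Orientation G → Subset n → Set
Convex D S = ∀ c x y → c ∉ S → x ∈ S → y ∈ S → ¬ TwoDipath D x c y

-- conv({u,v}) is the whole vertex set: the smallest convex superset of {u,v}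
-- is everything, i.e. every convex superset of {u,v} contains every vertex.
ConvIsAll : {n : ℕ} {G : Graph n} → Orientation G → Fin n → Fin n → Set
ConvIsAll {n} D u v = ∀ (S : Subset n) → Convex D S → u ∈ S → v ∈ S → ∀ x → x ∈ S

CompleteConvex : {n : ℕ} {G : Graph n} → Orientation G → Set
CompleteConvex D = ∀ u v → arc D u v ≡ true → ConvIsAll D u v

OnDirected3Cycle : {n : ℕ} {G : Graph n} → Orientation G → Fin n → Set
OnDirected3Cycle D v = ∃₂ λ a b → arc D v a ≡ true × arc D a b ≡ true × arc D b v ≡ true

-- Let a and b be the two neighbours of v. The pair {v, a} is spanned by an arc, so by complete
-- convexity it is not convex (b lies outside it). The only vertex outside {v, a} adjacent to v is
-- b, so b must be the centre of a 2-dipath between v and a; symmetrically a is the centre of one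
-- between v and b. Asymmetry of the orientation leaves only the directed 3-cycles vba and vab.
module Submission where

open import Defs
open import Data.Nat using (ℕ; _≤_)
open import Data.Nat.Properties using (suc-injective)
open import Data.Fin using (Fin; zero; suc)
import Data.Fin.Properties as Fin
open import Data.Fin.Subset using (Subset; _∈_; _∉_; ⁅_⁆; _∪_; ∣_∣; inside; outside)
open import Data.Fin.Subset.Properties using (x∈⁅x⁆; x∈⁅y⁆⇒x≡y; x∈p∪q⁻; x∈p∪q⁺)
open import Data.Vec using (_∷_; here; there)
open import Data.Vec.Properties using (lookup∘tabulate; []=⇒lookup; lookup⇒[]=)
open import Data.Bool using (true)
import Data.Bool as Bool
open import Data.Bool.Properties using (not-¬)
open import Data.Product using (_×_; _,_; ∃; ∃₂)
open import Data.Sum using (_⊎_; inj₁; inj₂; [_,_]′; swap)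
open import Function using (_∘_)
open import Relation.Nullary using (¬_; Dec; contradiction)
open import Relation.Nullary.Decidable using (_×-dec_; _⊎-dec_; decidable-stable)
open import Relation.Binary.PropositionalEquality using (_≡_; _≢_; ≢-sym; refl; sym; trans; cong)

∣p∣≡0⇒x∉p : ∀ {n} {p : Subset n} {x} → ∣ p ∣ ≡ 0 → x ∉ p
∣p∣≡0⇒x∉p {p = inside  ∷ p} ()
∣p∣≡0⇒x∉p {p = outside ∷ p} h (there x∈p) = ∣p∣≡0⇒x∉p h x∈p

∣p∣≡1⇒singleton : ∀ {n} {p : Subset n} → ∣ p ∣ ≡ 1 → ∃ λ a → a ∈ p × (∀ {x} → x ∈ p → x ≡ a)
∣p∣≡1⇒singleton {p = inside ∷ p} h = zero , here , unique
  where
  unique : ∀ {x} → x ∈ inside ∷ p → x ≡ zero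
  unique here        = refl
  unique (there x∈p) = contradiction x∈p (∣p∣≡0⇒x∉p (suc-injective h))
∣p∣≡1⇒singleton {p = outside ∷ p} h with ∣p∣≡1⇒singleton h
... | a , a∈p , unique = suc a , there a∈p , λ { (there x∈p) → cong suc (unique x∈p) }

∣p∣≡2⇒pair : ∀ {n} {p : Subset n} → ∣ p ∣ ≡ 2 →
             ∃₂ λ a b → a ≢ b × a ∈ p × b ∈ p × (∀ {x} → x ∈ p → x ≡ a ⊎ x ≡ b)
∣p∣≡2⇒pair {p = inside ∷ p} h with ∣p∣≡1⇒singleton (suc-injective h)
... | b , b∈p , unique = zero , suc b , (λ ()) , here , there b∈p , pair
  where
  pair : ∀ {x} → x ∈ inside ∷ p → x ≡ zero ⊎ x ≡ suc b
  pair here        = inj₁ refl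
  pair (there x∈p) = inj₂ (cong suc (unique x∈p))
∣p∣≡2⇒pair {p = outside ∷ p} h with ∣p∣≡2⇒pair h
... | a , b , a≢b , a∈p , b∈p , pair =
  suc a , suc b , a≢b ∘ Fin.suc-injective , there a∈p , there b∈p , pair′
  where
  pair′ : ∀ {x} → x ∈ outside ∷ p → x ≡ suc a ⊎ x ≡ suc b
  pair′ (there x∈p) with pair x∈p
  ... | inj₁ refl = inj₁ refl
  ... | inj₂ refl = inj₂ refl

x∈⁅u⁆∪⁅w⁆⇒x≡u⊎x≡w : ∀ {n} {u w x : Fin n} → x ∈ ⁅ u ⁆ ∪ ⁅ w ⁆ → x ≡ u ⊎ x ≡ w
x∈⁅u⁆∪⁅w⁆⇒x≡u⊎x≡w {u = u} {w} x∈S with x∈p∪q⁻ ⁅ u ⁆ ⁅ w ⁆ x∈S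
... | inj₁ x∈u = inj₁ (x∈⁅y⁆⇒x≡y u x∈u)
... | inj₂ x∈w = inj₂ (x∈⁅y⁆⇒x≡y w x∈w)

module _ {n : ℕ} {G : Graph n} where

  ∈nbhd⇒adj : ∀ {v x} → x ∈ nbhd G v → adj G v x ≡ true
  ∈nbhd⇒adj {v} {x} x∈N = trans (sym (lookup∘tabulate (adj G v) x)) ([]=⇒lookup x∈N)

  adj⇒∈nbhd : ∀ {v x} → adj G v x ≡ true → x ∈ nbhd G v
  adj⇒∈nbhd {v} {x} vx = lookup⇒[]= x (nbhd G v) (trans (lookup∘tabulate (adj G v) x) vx)

  degree≡2⇒neighbours : ∀ {v} → degree G v ≡ 2 →
    ∃₂ λ a b → a ≢ b × adj G v a ≡ true × adj G v b ≡ true ×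
               (∀ {c} → adj G v c ≡ true → c ≡ a ⊎ c ≡ b)
  degree≡2⇒neighbours deg with ∣p∣≡2⇒pair deg
  ... | a , b , a≢b , a∈N , b∈N , pair =
    a , b , a≢b , ∈nbhd⇒adj a∈N , ∈nbhd⇒adj b∈N , λ vc → pair (adj⇒∈nbhd vc)

  module _ (D : Orientation G) where

    Between : Fin n → Fin n → Fin n → Set
    Between u c w = (arc D u c ≡ true × arc D c w ≡ true) ⊎ (arc D w c ≡ true × arc D c u ≡ true)

    between? : ∀ u c w → Dec (Between u c w)
    between? u c w = (arc D u c Bool.≟ true ×-dec arc D c w Bool.≟ true)
               ⊎-dec (arc D w c Bool.≟ true ×-dec arc D c u Bool.≟ true)

    arc-asym′ : ∀ {x y : Fin n} → arc D x y ≡ true → ¬ arc D y x ≡ true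
    arc-asym′ {x} {y} xy = not-¬ (arc-asym D x y xy)

    pair-convex : ∀ {u w : Fin n} → (∀ c → c ∉ ⁅ u ⁆ ∪ ⁅ w ⁆ → ¬ Between u c w) →
                  Convex D (⁅ u ⁆ ∪ ⁅ w ⁆)
    pair-convex {u} {w} no-centre c _ _ c∉S x∈S y∈S (xc , cy , _ , _) =
      ends (x∈⁅u⁆∪⁅w⁆⇒x≡u⊎x≡w x∈S) (x∈⁅u⁆∪⁅w⁆⇒x≡u⊎x≡w y∈S) xc cy
      where
      ends : ∀ {x y} → x ≡ u ⊎ x ≡ w → y ≡ u ⊎ y ≡ w → arc D x c ≡ true → ¬ arc D c y ≡ true
      ends (inj₁ refl) (inj₁ refl) xc cy = arc-asym′ xc cy
      ends (inj₂ refl) (inj₂ refl) xc cy = arc-asym′ xc cy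
      ends (inj₁ refl) (inj₂ refl) xc cy = no-centre c c∉S (inj₁ (xc , cy))
      ends (inj₂ refl) (inj₁ refl) xc cy = no-centre c c∉S (inj₂ (xc , cy))

    complete-convex⇒pair-not-convex : CompleteConvex D → ∀ {u w z : Fin n} → adj G u w ≡ true →
      z ≢ u → z ≢ w → ¬ Convex D (⁅ u ⁆ ∪ ⁅ w ⁆)
    complete-convex⇒pair-not-convex cc {u} {w} {z} uw z≢u z≢w convex =
      [ z≢u , z≢w ]′ (x∈⁅u⁆∪⁅w⁆⇒x≡u⊎x≡w z∈S)
      where
      u∈S : u ∈ ⁅ u ⁆ ∪ ⁅ w ⁆
      u∈S = x∈p∪q⁺ (inj₁ (x∈⁅x⁆ u))
      w∈S : w ∈ ⁅ u ⁆ ∪ ⁅ w ⁆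
      w∈S = x∈p∪q⁺ (inj₂ (x∈⁅x⁆ w))
      z∈S : z ∈ ⁅ u ⁆ ∪ ⁅ w ⁆
      z∈S with edge-arc D u w uw
      ... | inj₁ u→w = cc u w u→w _ convex u∈S w∈S z
      ... | inj₂ w→u = cc w u w→u _ convex w∈S u∈S z

    between⇒adj : ∀ {u c w : Fin n} → Between u c w → adj G u c ≡ true
    between⇒adj {u} {c} (inj₁ (uc , _)) = arc-edge D u c uc
    between⇒adj {u} {c} (inj₂ (_ , cu)) = adj-sym G c u (arc-edge D c u cu)

    complete-convex⇒between-neighbours : CompleteConvex D → ∀ {v a b : Fin n} → a ≢ b →
      adj G v a ≡ true → adj G v b ≡ true → (∀ {c} → adj G v c ≡ true → c ≡ a ⊎ c ≡ b) →
      Between v b a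
    complete-convex⇒between-neighbours cc {v} {a} {b} a≢b va vb neighbours =
      decidable-stable (between? v b a) λ ¬vba →
        complete-convex⇒pair-not-convex cc va b≢v (≢-sym a≢b)
          (pair-convex (λ c c∉S vca → only-b c∉S vca ¬vba))
      where
      b≢v : b ≢ v
      b≢v refl = not-¬ (adj-irrefl G v) vb
      only-b : ∀ {c} → c ∉ ⁅ v ⁆ ∪ ⁅ a ⁆ → Between v c a → ¬ ¬ Between v b a
      only-b {c} c∉S vca with neighbours (between⇒adj vca)
      ... | inj₁ refl = contradiction (x∈p∪q⁺ (inj₂ (x∈⁅x⁆ c))) c∉S
      ... | inj₂ refl = λ ¬vba → ¬vba vca

    between-both-ways⇒cycle : ∀ {v a b : Fin n} → Between v b a → Between v a b → OnDirected3Cycle D v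
    between-both-ways⇒cycle (inj₁ (vb , ba)) (inj₂ (_ , av)) = _ , _ , vb , ba , av
    between-both-ways⇒cycle (inj₂ (ab , bv)) (inj₁ (va , _)) = _ , _ , va , ab , bv
    between-both-ways⇒cycle (inj₁ (_ , ba)) (inj₁ (_ , ab)) = contradiction ba (arc-asym′ ab)
    between-both-ways⇒cycle (inj₂ (ab , _)) (inj₂ (ba , _)) = contradiction ba (arc-asym′ ab)

lemma6 : (n : ℕ) → 2 ≤ n → (G : Graph n) → Connected G → (v : Fin n) → degree G v ≡ 2
       → (D : Orientation G) → CompleteConvex D → OnDirected3Cycle D v
lemma6 n _ G _ v deg D cc with degree≡2⇒neighbours {G = G} {v} deg
... | a , b , a≢b , va , vb , neighbours =
  between-both-ways⇒cycle D
    (complete-convex⇒between-neighbours D cc a≢b va vb neighbours)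
    (complete-convex⇒between-neighbours D cc (≢-sym a≢b) vb va (λ vc → swap (neighbours vc)))
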